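{- Let $\Gamma$ be a simple digraph with $|V(\Gamma)|=n$ and let $k$ be an integer with $\operatorname{Z}(\Gamma)\le k\le n$. Then $\operatorname{pt}_k(\Gamma)=\operatorname{pt}_k(\Gamma^T)$.
   Context: A simple digraph has a finite vertex set and no loops or parallel arcs (opposite arcs allowed); $\Gamma^T$ is obtained by reversing every arc. Zero forcing: vertices are blue or white; a blue vertex $u$ with exactly one white out-neighbor $w$ may force $w$ ($u\to w$), turning it blue. A set $\mathcal F$ of forces is a set of forces of $B\subseteq V(\Gamma)$ if, starting with exactly $B$ blue, the forces in $\mathcal F$ can be validly performed in some order after which no further force is possible. Put $\mathcal F^{[0]}=B$ and $\mathcal F^{[t+1]}=\mathcal F^{[t]}\cup\{w\notin\mathcal F^{[t]}:(u\to w)\in\mathcal F,\ u\in\mathcal F^{[t]},\ w$ the only out-neighbor of $u$ outside $\mathcal F^{[t]}\}$; $\operatorname{pt}(\Gamma;\mathcal F)$ is the least $t$ with $\mathcal F^{[t]}=V(\Gamma)$ ($\infty$ if none); $\operatorname{pt}(\Gamma;B)=\min_{\mathcal F}\operatorname{pt}(\Gamma;\mathcal F)$. $B$ is a zero forcing set if all vertices can be forced blue; $\operatorname{Z}(\Gamma)$ is the minimum size of a zero forcing set. The $k$-propagation time is $\operatorname{pt}_k(\Gamma)=\min\{\operatorname{pt}(\Gamma;B): B$ a zero forcing set of $\Gamma$ with $|B|=k\}$. -}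

module Defs where

open import Data.Nat using (ℕ; zero; suc; _≤_; _<_)
open import Data.Bool using (Bool; true; false)
open import Data.Fin using (Fin)
open import Data.Fin.Subset using (Subset; _∈_; _∉_; _∪_; ⁅_⁆; ∣_∣)
open import Data.List using (List; []; _∷_)
import Data.List.Membership.Propositional as L
open import Data.Product using (Σ; _×_; _,_; ∃)
open import Data.Sum using (_⊎_)
open import Relation.Nullary using (¬_)
open import Relation.Binary.PropositionalEquality using (_≡_)

-- A simple digraph on vertex set Fin n: arc relation, no loops.
-- (Parallel arcs are impossible for a relation; opposite arcs allowed.)
record Digraph (n : ℕ) : Set where
  field
    arc      : Fin n → Fin n → Bool
    loopless : ∀ i → arc i i ≡ false
open Digraph public

transpose : ∀ {n} → Digraph n → Digraph n
transpose Γ = record { arc = λ u w → arc Γ w u ; loopless = loopless Γ }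

Force : ℕ → Set
Force n = Fin n × Fin n

-- u → w is a valid force when S is the blue set.
ValidForce : ∀ {n} → Digraph n → Subset n → Fin n → Fin n → Set
ValidForce Γ S u w =
  u ∈ S × w ∉ S × arc Γ u w ≡ true ×
  (∀ x → arc Γ u x ≡ true → x ∉ S → x ≡ w)

data Run {n} (Γ : Digraph n) : Subset n → List (Force n) → Subset n → Set where
  done : ∀ {S} → Run Γ S [] S
  step : ∀ {S u w L T} → ValidForce Γ S u w →
         Run Γ (S ∪ ⁅ w ⁆) L T → Run Γ S ((u , w) ∷ L) T

Stalled : ∀ {n} → Digraph n → Subset n → Set
Stalled Γ T = ∀ u w → ¬ ValidForce Γ T u w

-- The set of forces {elements of L} is a set of forces of B
-- (L is a chronological ordering of it).
ForcesOf : ∀ {n} → Digraph n → Subset n → List (Force n) → Set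
ForcesOf Γ B L = Σ (Subset _) λ T → Run Γ B L T × Stalled Γ T

ZeroForcingSet : ∀ {n} → Digraph n → Subset n → Set
ZeroForcingSet Γ B =
  Σ (List (Force _)) λ L → Σ (Subset _) λ T → Run Γ B L T × (∀ v → v ∈ T)

IsMin : (ℕ → Set) → ℕ → Set
IsMin P m = P m × (∀ m' → P m' → m ≤ m')

ZeroForcingNumber : ∀ {n} → Digraph n → ℕ → Set
ZeroForcingNumber Γ = IsMin (λ s → Σ (Subset _) λ B → ZeroForcingSet Γ B × ∣ B ∣ ≡ s)

InStage : ∀ {n} → Digraph n → Subset n → List (Force n) → ℕ → Fin n → Set
InStage Γ B F zero v = v ∈ B
InStage Γ B F (suc t) v =
  InStage Γ B F t v ⊎
  (¬ InStage Γ B F t v ×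
   Σ (Fin _) λ u → (u , v) L.∈ F × InStage Γ B F t u × arc Γ u v ≡ true ×
     (∀ x → arc Γ u x ≡ true → ¬ InStage Γ B F t x → x ≡ v))

Full : ∀ {n} → Digraph n → Subset n → List (Force n) → ℕ → Set
Full Γ B F t = ∀ v → InStage Γ B F t v

-- pt(Γ;F) = t  (finite value; pt = ∞ iff no t satisfies this)
PtF : ∀ {n} → Digraph n → Subset n → List (Force n) → ℕ → Set
PtF Γ B F = IsMin (Full Γ B F)

PtB : ∀ {n} → Digraph n → Subset n → ℕ → Set
PtB Γ B = IsMin (λ s → Σ (List (Force _)) λ F → ForcesOf Γ B F × PtF Γ B F s)

Ptk : ∀ {n} → Digraph n → ℕ → ℕ → Set
Ptk Γ k = IsMin (λ s → Σ (Subset _) λ B → ZeroForcingSet Γ B × ∣ B ∣ ≡ k × PtB Γ B s)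

-- Let B be a zero forcing set of Γ and
-- L a chronological list of forces of B turning every vertex blue by time s.
-- Reverse the list and every force in it, and start in Γᵀ from the terminal
-- set B' of vertices that never force in L.  Then
--   * the reversed list is a valid run in Γᵀ from B' turning everything blue
--     (reverse-run);
--   * it turns everything blue by time s as well: if u forces w, then u is
--     blue in the reversed process as soon as t + m ≥ s, where w is still
--     white at stage m of the original process (pending-reversed);
--   * |B'| = |B|, since both complete runs have n - |L| initial vertices.
-- So every pair (k, s) achievable in Γ is achievable in Γᵀ, and conversely
-- because (Γᵀ)ᵀ is Γ.
module Submission where

open import Defs
open import Data.Nat using (ℕ; zero; suc; _≤_; _<_; _+_; z≤n; s≤s)
open import Data.Nat.Properties
  using (≮⇒≥; <⇒≤; +-cancelʳ-≡; m≤n+m; ≤-antisym; +-suc; +-identityʳ; ≤-trans; ≤-refl; anyUpTo?)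
open import Data.Nat.Induction using (<-rec)
open import Data.Bool using (true)
import Data.Bool.Properties as Bool
open import Data.Fin using (Fin; _≟_)
import Data.Fin as Fin
import Data.Fin.Properties as FinP
open import Data.Fin.Subset using (Subset; _∈_; _∉_; _∪_; ⁅_⁆; ∣_∣; ∁; ⊥; inside; outside)
open import Data.Fin.Subset.Properties
  using (_∈?_; ∉⊥; x∈⁅x⁆; x∈⁅y⁆⇒x≡y; x∈∁p⇒x∉p; x∉∁p⇒x∈p; x∉p⇒x∈∁p; x∈p∪q⁻; x∈p∪q⁺;
         ⊆-antisym; ⊆⊤; ∣⊤∣≡n; ∣p∣≤n; ∪-assoc; ∪-comm; ∪-identityˡ; ∪-identityʳ)
open import Data.Vec using (_∷_; here; there)
open import Data.List using (List; []; _∷_; _∷ʳ_; length; reverse; map)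
open import Data.List.Properties using (unfold-reverse; length-reverse; length-map)
open import Data.List.Membership.Propositional using () renaming (_∈_ to _∈ᴸ_)
open import Data.List.Membership.Propositional.Properties using (∈-map⁺)
import Data.List.Relation.Unary.Any as Any
open import Data.List.Relation.Unary.Any.Properties using (reverse⁺)
open import Data.Product using (Σ; _×_; _,_; proj₁; proj₂; swap)
import Data.Product as Product
import Data.Product.Properties as ProductP
open import Data.Sum using (_⊎_; inj₁; inj₂)
open import Data.Empty using (⊥-elim)
open import Function using (_∘_)
open import Function.Bundles using (_⇔_; mk⇔)
open import Relation.Nullary using (¬_; Dec; yes; no)
open import Relation.Nullary.Decidable using (map′; _×-dec_; _⊎-dec_; _→-dec_; ¬?)
open import Relation.Binary.PropositionalEquality using (_≡_; _≢_; refl; sym; trans; cong; subst)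
open Relation.Binary.PropositionalEquality.≡-Reasoning

∣p∪⁅x⁆∣≡1+∣p∣ : ∀ {n} (p : Subset n) (x : Fin n) → x ∉ p → ∣ p ∪ ⁅ x ⁆ ∣ ≡ suc ∣ p ∣
∣p∪⁅x⁆∣≡1+∣p∣ (inside ∷ p) Fin.zero x∉p = ⊥-elim (x∉p here)
∣p∪⁅x⁆∣≡1+∣p∣ (outside ∷ p) Fin.zero _ = cong (suc ∘ ∣_∣) (∪-identityʳ p)
∣p∪⁅x⁆∣≡1+∣p∣ (inside ∷ p) (Fin.suc x) x∉p = cong suc (∣p∪⁅x⁆∣≡1+∣p∣ p x (x∉p ∘ there))
∣p∪⁅x⁆∣≡1+∣p∣ (outside ∷ p) (Fin.suc x) x∉p = ∣p∪⁅x⁆∣≡1+∣p∣ p x (x∉p ∘ there)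

∣full∣≡n : ∀ {n} (p : Subset n) → (∀ v → v ∈ p) → ∣ p ∣ ≡ n
∣full∣≡n {n} p all = trans (cong ∣_∣ (⊆-antisym ⊆⊤ (λ {v} _ → all v))) (∣⊤∣≡n n)

∈∁⊥ : ∀ {n} (v : Fin n) → v ∈ ∁ ⊥
∈∁⊥ v = x∉p⇒x∈∁p ∉⊥

∁[p∪⁅x⁆]∪⁅x⁆≡∁p : ∀ {n} (p : Subset n) (x : Fin n) → x ∉ p → ∁ (p ∪ ⁅ x ⁆) ∪ ⁅ x ⁆ ≡ ∁ p
∁[p∪⁅x⁆]∪⁅x⁆≡∁p (inside ∷ p) Fin.zero x∉p = ⊥-elim (x∉p here)
∁[p∪⁅x⁆]∪⁅x⁆≡∁p (outside ∷ p) Fin.zero _ =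
  cong (inside ∷_) (trans (∪-identityʳ (∁ (p ∪ ⊥))) (cong ∁ (∪-identityʳ p)))
∁[p∪⁅x⁆]∪⁅x⁆≡∁p (inside ∷ p) (Fin.suc x) x∉p = cong (outside ∷_) (∁[p∪⁅x⁆]∪⁅x⁆≡∁p p x (x∉p ∘ there))
∁[p∪⁅x⁆]∪⁅x⁆≡∁p (outside ∷ p) (Fin.suc x) x∉p = cong (inside ∷_) (∁[p∪⁅x⁆]∪⁅x⁆≡∁p p x (x∉p ∘ there))

-- Lists of forces and their reversal

reversed : ∀ {n} → List (Force n) → List (Force n)
reversed = reverse ∘ map swap

reversed-∷ : ∀ {n} (u w : Fin n) (L : List (Force n)) → reversed ((u , w) ∷ L) ≡ reversed L ∷ʳ (w , u)
reversed-∷ u w L = unfold-reverse (w , u) (map swap L)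

length-reversed : ∀ {n} (L : List (Force n)) → length (reversed L) ≡ length L
length-reversed L = trans (length-reverse (map swap L)) (length-map swap L)

∈-reversed : ∀ {n} {u w : Fin n} {L : List (Force n)} → (u , w) ∈ᴸ L → (w , u) ∈ᴸ reversed L
∈-reversed = reverse⁺ ∘ ∈-map⁺ swap

forcers : ∀ {n} → List (Force n) → Subset n
forcers [] = ⊥
forcers ((u , _) ∷ L) = ⁅ u ⁆ ∪ forcers L

∈-forcers : ∀ {n} {x : Fin n} (L : List (Force n)) → x ∈ forcers L → Σ (Fin n) λ y → (x , y) ∈ᴸ L
∈-forcers [] x∈ = ⊥-elim (∉⊥ x∈)
∈-forcers ((u , w) ∷ L) x∈ with x∈p∪q⁻ ⁅ u ⁆ (forcers L) x∈
... | inj₁ x∈⁅u⁆ rewrite x∈⁅y⁆⇒x≡y u x∈⁅u⁆ = w , Any.here refl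
... | inj₂ x∈rest = Product.map₂ Any.there (∈-forcers L x∈rest)

run-cast : ∀ {n} {Γ : Digraph n} {S S' L L' T T'} →
           S ≡ S' → L ≡ L' → T ≡ T' → Run Γ S L T → Run Γ S' L' T'
run-cast refl refl refl r = r

run-snoc : ∀ {n} {Γ : Digraph n} {S L T u w} →
           Run Γ S L T → ValidForce Γ T u w → Run Γ S (L ∷ʳ (u , w)) (T ∪ ⁅ w ⁆)
run-snoc done v = step v done
run-snoc (step v' r) v = step v' (run-snoc r v)

full-stalled : ∀ {n} (Γ : Digraph n) {T} → (∀ v → v ∈ T) → Stalled Γ T
full-stalled Γ all u w (_ , w∉T , _) = w∉T (all w)

module Runs {n : ℕ} (Γ : Digraph n) where

  -- Each force turns exactly one new vertex blue.
  run-card : ∀ {S L T} → Run Γ S L T → ∣ T ∣ ≡ ∣ S ∣ + length L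
  run-card {S} done = sym (+-identityʳ ∣ S ∣)
  run-card {S} {(_ , w) ∷ L} {T} (step (_ , w∉S , _) r) = begin
    ∣ T ∣                    ≡⟨ run-card r ⟩
    ∣ S ∪ ⁅ w ⁆ ∣ + length L ≡⟨ cong (_+ length L) (∣p∪⁅x⁆∣≡1+∣p∣ S w w∉S) ⟩
    suc (∣ S ∣ + length L)   ≡⟨ sym (+-suc ∣ S ∣ (length L)) ⟩
    ∣ S ∣ + suc (length L)   ∎

  run-length≤n : ∀ {S L T} → Run Γ S L T → length L ≤ n
  run-length≤n {S} {L} {T} r =
    ≤-trans (m≤n+m (length L) ∣ S ∣) (subst (_≤ n) (run-card r) (∣p∣≤n T))

  complete-run-card : ∀ {S L T} → Run Γ S L T → (∀ v → v ∈ T) → ∣ S ∣ + length L ≡ n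
  complete-run-card {T = T} r all = trans (sym (run-card r)) (∣full∣≡n T all)

  run-mono : ∀ {S L T x} → Run Γ S L T → x ∈ S → x ∈ T
  run-mono done x∈S = x∈S
  run-mono (step _ r) x∈S = run-mono r (x∈p∪q⁺ (inj₁ x∈S))

  run-target-blue : ∀ {S L T u w} → Run Γ S L T → (u , w) ∈ᴸ L → w ∈ T
  run-target-blue {w = w} (step _ r) (Any.here refl) = run-mono r (x∈p∪q⁺ (inj₂ (x∈⁅x⁆ w)))
  run-target-blue (step _ r) (Any.there uw) = run-target-blue r uw

  run-target-new : ∀ {S L T u w} → Run Γ S L T → (u , w) ∈ᴸ L → w ∉ S
  run-target-new (step (_ , w∉S , _) r) (Any.here refl) = w∉S
  run-target-new (step _ r) (Any.there uw) w∈S = run-target-new r uw (x∈p∪q⁺ (inj₁ w∈S))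

  run-arc : ∀ {S L T u w} → Run Γ S L T → (u , w) ∈ᴸ L → arc Γ u w ≡ true
  run-arc (step (_ , _ , uw-arc , _) r) (Any.here refl) = uw-arc
  run-arc (step _ r) (Any.there uw) = run-arc r uw

  -- Every vertex is forced at most once, so it has at most one forcer.
  run-unique-forcer : ∀ {S L T a b c} → Run Γ S L T → (a , b) ∈ᴸ L → (c , b) ∈ᴸ L → a ≡ c
  run-unique-forcer (step _ r) (Any.here refl) (Any.here refl) = refl
  run-unique-forcer {b = b} (step _ r) (Any.here refl) (Any.there cb) =
    ⊥-elim (run-target-new r cb (x∈p∪q⁺ (inj₂ (x∈⁅x⁆ b))))
  run-unique-forcer {b = b} (step _ r) (Any.there ab) (Any.here refl) =
    ⊥-elim (run-target-new r ab (x∈p∪q⁺ (inj₂ (x∈⁅x⁆ b))))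
  run-unique-forcer (step _ r) (Any.there ab) (Any.there cb) = run-unique-forcer r ab cb

-- Reversing a run: the reversed forces are valid in Γᵀ

module Reversal {n : ℕ} (Γ : Digraph n) where

  Settled : Subset n → Subset n → Set
  Settled S U = ∀ x → x ∈ U → x ∈ S × (∀ y → arc Γ x y ≡ true → y ∈ S)

  module _ {S U u w} (valid : ValidForce Γ S u w) (settled : Settled S U) where
    private
      u∈S : u ∈ S
      u∈S = proj₁ valid
      w∉S : w ∉ S
      w∉S = proj₁ (proj₂ valid)
      uw-arc : arc Γ u w ≡ true
      uw-arc = proj₁ (proj₂ (proj₂ valid))
      only-w : ∀ x → arc Γ u x ≡ true → x ∉ S → x ≡ w
      only-w = proj₂ (proj₂ (proj₂ valid))

    -- The forcer u is not settled yet (its out-neighbour w is white).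
    forcer-unsettled : u ∉ U
    forcer-unsettled u∈U = w∉S (proj₂ (settled u u∈U) w uw-arc)

    settled-step : Settled (S ∪ ⁅ w ⁆) (U ∪ ⁅ u ⁆)
    settled-step x x∈ with x∈p∪q⁻ U ⁅ u ⁆ x∈
    ... | inj₁ x∈U = Product.map blue (λ out y xy → blue (out y xy)) (settled x x∈U)
      where
      blue : ∀ {y} → y ∈ S → y ∈ S ∪ ⁅ w ⁆
      blue y∈S = x∈p∪q⁺ (inj₁ y∈S)
    ... | inj₂ x∈⁅u⁆ rewrite x∈⁅y⁆⇒x≡y u x∈⁅u⁆ = x∈p∪q⁺ (inj₁ u∈S) , out
      where
      out : ∀ y → arc Γ u y ≡ true → y ∈ S ∪ ⁅ w ⁆
      out y uy with y ∈? S
      ... | yes y∈S = x∈p∪q⁺ (inj₁ y∈S)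
      ... | no y∉S rewrite only-w y uy y∉S = x∈p∪q⁺ (inj₂ (x∈⁅x⁆ w))

    reverse-force : ValidForce (transpose Γ) (∁ (U ∪ ⁅ u ⁆)) w u
    reverse-force = x∉p⇒x∈∁p w∉U∪⁅u⁆ , (λ u∈ → x∈∁p⇒x∉p u∈ (x∈p∪q⁺ (inj₂ (x∈⁅x⁆ u)))) , uw-arc , only-u
      where
      w∉U∪⁅u⁆ : w ∉ U ∪ ⁅ u ⁆
      w∉U∪⁅u⁆ w∈ with x∈p∪q⁻ U ⁅ u ⁆ w∈
      ... | inj₁ w∈U = w∉S (proj₁ (settled w w∈U))
      ... | inj₂ w∈⁅u⁆ = w∉S (subst (_∈ S) (sym (x∈⁅y⁆⇒x≡y u w∈⁅u⁆)) u∈S)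
      only-u : ∀ x → arc Γ x w ≡ true → x ∉ ∁ (U ∪ ⁅ u ⁆) → x ≡ u
      only-u x xw x∉ with x∈p∪q⁻ U ⁅ u ⁆ (x∉∁p⇒x∈p x∉)
      ... | inj₁ x∈U = ⊥-elim (w∉S (proj₂ (settled x x∈U) w xw))
      ... | inj₂ x∈⁅u⁆ = x∈⁅y⁆⇒x≡y u x∈⁅u⁆

  reverse-run-from : ∀ {S L T U} → Run Γ S L T → Settled S U →
                     Run (transpose Γ) (∁ (forcers L ∪ U)) (reversed L) (∁ U)
  reverse-run-from {U = U} done _ = run-cast (cong ∁ (sym (∪-identityˡ U))) refl refl done
  reverse-run-from {U = U} (step {u = u} {w} {L} valid r) settled =
    run-cast (cong ∁ regroup) (sym (reversed-∷ u w L))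
             (∁[p∪⁅x⁆]∪⁅x⁆≡∁p U u (forcer-unsettled valid settled))
             (run-snoc (reverse-run-from r (settled-step valid settled)) (reverse-force valid settled))
    where
    regroup : forcers L ∪ (U ∪ ⁅ u ⁆) ≡ (⁅ u ⁆ ∪ forcers L) ∪ U
    regroup = begin
      forcers L ∪ (U ∪ ⁅ u ⁆)   ≡⟨ sym (∪-assoc (forcers L) U ⁅ u ⁆) ⟩
      (forcers L ∪ U) ∪ ⁅ u ⁆   ≡⟨ ∪-comm (forcers L ∪ U) ⁅ u ⁆ ⟩
      ⁅ u ⁆ ∪ (forcers L ∪ U)   ≡⟨ sym (∪-assoc ⁅ u ⁆ (forcers L) U) ⟩
      (⁅ u ⁆ ∪ forcers L) ∪ U   ∎

  reverse-run : ∀ {S L T} → Run Γ S L T → Run (transpose Γ) (∁ (forcers L)) (reversed L) (∁ ⊥)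
  reverse-run {L = L} r =
    run-cast (cong ∁ (∪-identityʳ (forcers L))) refl refl
             (reverse-run-from r (λ x x∈⊥ → ⊥-elim (∉⊥ x∈⊥)))

-- Deciding the forcing notions (all quantifiers range over finite sets)

module Decisions {n : ℕ} (Γ : Digraph n) where

  arc? : ∀ u v → Dec (arc Γ u v ≡ true)
  arc? u v = arc Γ u v Bool.≟ true

  force∈? : ∀ (f : Force n) F → Dec (f ∈ᴸ F)
  force∈? f = Any.any? (ProductP.≡-dec _≟_ _≟_ f)

  only-white? : ∀ {P : Fin n → Set} → (∀ x → Dec (P x)) → ∀ u w →
                Dec (∀ x → arc Γ u x ≡ true → ¬ P x → x ≡ w)
  only-white? P? u w = FinP.all? (λ x → arc? u x →-dec (¬? (P? x) →-dec (x ≟ w)))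

  in-stage? : ∀ S F t v → Dec (InStage Γ S F t v)
  in-stage? S F zero v = v ∈? S
  in-stage? S F (suc t) v =
    in-stage? S F t v ⊎-dec (¬? (in-stage? S F t v) ×-dec
      FinP.any? (λ u → force∈? (u , v) F ×-dec in-stage? S F t u ×-dec arc? u v ×-dec
                       only-white? (in-stage? S F t) u v))

  full? : ∀ S F t → Dec (Full Γ S F t)
  full? S F t = FinP.all? (in-stage? S F t)

  valid? : ∀ S u w → Dec (ValidForce Γ S u w)
  valid? S u w = (u ∈? S) ×-dec ¬? (w ∈? S) ×-dec arc? u w ×-dec only-white? (_∈? S) u w

  stalled? : ∀ S → Dec (Stalled Γ S)
  stalled? S = FinP.all? (λ u → FinP.all? (λ w → ¬? (valid? S u w)))

  forces-of? : ∀ S F → Dec (ForcesOf Γ S F)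
  forces-of? S [] with stalled? S
  ... | yes stalled = yes (S , done , stalled)
  ... | no unstalled = no λ { (_ , done , stalled) → unstalled stalled }
  forces-of? S ((u , w) ∷ F) with valid? S u w | forces-of? (S ∪ ⁅ w ⁆) F
  ... | no invalid | _ = no λ { (_ , step valid _ , _) → invalid valid }
  ... | yes valid | yes (T , r , stalled) = yes (T , step valid r , stalled)
  ... | yes _ | no none = no λ { (T , step _ r , stalled) → none (T , r , stalled) }

-- Stages of the reversed process

module ReversedStages {n : ℕ} (Γ : Digraph n) {B L T} (r : Run Γ B L T) where
  open Runs Γ
  open Decisions using (in-stage?)

  Stage : ℕ → Fin n → Set
  Stage = InStage Γ B L

  B' : Subset n
  B' = ∁ (forcers L)

  Stageᵀ : ℕ → Fin n → Set
  Stageᵀ = InStage (transpose Γ) B' (reversed L)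

  stage-blue : ∀ t v → Stage t v → v ∈ T
  stage-blue zero v v∈B = run-mono r v∈B
  stage-blue (suc t) v (inj₁ v∈) = stage-blue t v v∈
  stage-blue (suc t) v (inj₂ (_ , _ , uv , _)) = run-target-blue r uv

  -- A vertex b enters the stages only through its unique forcer a: if b is
  -- blue at stage j+1, then a and all out-neighbours of a except b are blue
  -- at stage j.
  forced-stage : ∀ {a b} → (a , b) ∈ᴸ L → ∀ j → Stage (suc j) b →
                 Stage j a × (∀ z → arc Γ a z ≡ true → z ≢ b → Stage j z)
  forced-stage ab zero (inj₁ b∈B) = ⊥-elim (run-target-new r ab b∈B)
  forced-stage ab (suc j) (inj₁ b∈) =
    Product.map inj₁ (λ out z az z≢b → inj₁ (out z az z≢b)) (forced-stage ab j b∈)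
  forced-stage {b = b} ab j (inj₂ (_ , c , cb , c∈ , _ , only-b)) with run-unique-forcer r cb ab
  ... | refl = c∈ , others
    where
    others : ∀ z → arc Γ c z ≡ true → z ≢ b → Stage j z
    others z cz z≢b with in-stage? Γ B L j z
    ... | yes z∈ = z∈
    ... | no z∉ = ⊥-elim (z≢b (only-b z cz z∉))

  Pending : ℕ → Fin n → Set
  Pending m u = u ∈ B' ⊎ Σ (Fin n) λ w → (u , w) ∈ᴸ L × ¬ Stage m w

  pending-or-done : ∀ m u → Pending m u ⊎ Σ (Fin n) λ w → (u , w) ∈ᴸ L × Stage m w
  pending-or-done m u with u ∈? B'
  ... | yes u∈B' = inj₁ (inj₁ u∈B')
  ... | no u∉B' with ∈-forcers L (x∉∁p⇒x∈p u∉B')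
  ...   | w , uw with in-stage? Γ B L m w
  ...     | yes w∈ = inj₂ (w , uw , w∈)
  ...     | no w∉ = inj₁ (inj₂ (w , uw , w∉))

  -- Every vertex is pending at the start: its target is not in B.
  initially-pending : ∀ u → Pending 0 u
  initially-pending u with pending-or-done 0 u
  ... | inj₁ pending = pending
  ... | inj₂ (w , uw , w∈B) = ⊥-elim (run-target-new r uw w∈B)

  -- A vertex white at stage m is pending at stage m+1 (else it forced earlier).
  white-pending : ∀ {w m} → ¬ Stage m w → Pending (suc m) w
  white-pending {w} {m} w∉ with pending-or-done (suc m) w
  ... | inj₁ pending = pending
  ... | inj₂ (y , wy , y∈) = ⊥-elim (w∉ (proj₁ (forced-stage wy m y∈)))

  -- If u forces a vertex w white at stage m, every other in-neighbour x of w
  -- is pending at stage m+1 (else w would be blue at stage m).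
  rival-pending : ∀ {u w x m} → (u , w) ∈ᴸ L → ¬ Stage m w →
                  arc Γ x w ≡ true → x ≢ u → Pending (suc m) x
  rival-pending {w = w} {x = x} {m = m} uw w∉ xw x≢u with pending-or-done (suc m) x
  ... | inj₁ pending = pending
  ... | inj₂ (y , xy , y∈) with y ≟ w
  ...   | yes refl = ⊥-elim (x≢u (run-unique-forcer r xy uw))
  ...   | no y≢w = ⊥-elim (w∉ (proj₂ (forced-stage xy m y∈) w xw (y≢w ∘ sym)))

  pending-reversed : ∀ t m → Full Γ B L (t + m) → ∀ u → Pending m u → Stageᵀ t u
  pending-reversed zero m _ u (inj₁ u∈B') = u∈B'
  pending-reversed zero m full u (inj₂ (w , _ , w∉)) = ⊥-elim (w∉ (full w))
  pending-reversed (suc t) m full u = advance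
    where
    IH : ∀ v → Pending (suc m) v → Stageᵀ t v
    IH = pending-reversed t (suc m) (subst (Full Γ B L) (sym (+-suc t m)) full)
    advance : Pending m u → Stageᵀ (suc t) u
    advance (inj₁ u∈B') = inj₁ (IH u (inj₁ u∈B'))
    advance (inj₂ (w , uw , w∉)) with in-stage? (transpose Γ) B' (reversed L) t u
    ... | yes u∈ = inj₁ u∈
    ... | no u∉ = inj₂ (u∉ , w , ∈-reversed uw , IH w (white-pending w∉) , run-arc r uw , only-u)
      where
      only-u : ∀ x → arc Γ x w ≡ true → ¬ Stageᵀ t x → x ≡ u
      only-u x xw x∉ with x ≟ u
      ... | yes x≡u = x≡u
      ... | no x≢u = ⊥-elim (x∉ (IH x (rival-pending uw w∉ xw x≢u)))

  full-reversed : ∀ s → Full Γ B L s → Full (transpose Γ) B' (reversed L) s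
  full-reversed s full u =
    pending-reversed s 0 (subst (Full Γ B L) (sym (+-identityʳ s)) full) u (initially-pending u)

-- Achievable propagation times

Reaches : ∀ {n} → Digraph n → Subset n → ℕ → Set
Reaches Γ B s = Σ (List (Force _)) λ F → ForcesOf Γ B F × Full Γ B F s

Achieves : ∀ {n} → Digraph n → ℕ → ℕ → Set
Achieves Γ k s = Σ (Subset _) λ B → ZeroForcingSet Γ B × ∣ B ∣ ≡ k × Reaches Γ B s

achieves-transpose : ∀ {n} (Γ : Digraph n) {k s} → Achieves Γ k s → Achieves (transpose Γ) k s
achieves-transpose {n} Γ {k} {s} (B , _ , ∣B∣≡k , L , (T , r , _) , full) =
  B' , (reversed L , ∁ ⊥ , rᵀ , ∈∁⊥) , ∣B'∣≡k ,
  reversed L , (∁ ⊥ , rᵀ , full-stalled (transpose Γ) ∈∁⊥) , full-reversed s full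
  where
  open ReversedStages Γ r using (B'; stage-blue; full-reversed)
  rᵀ : Run (transpose Γ) B' (reversed L) (∁ ⊥)
  rᵀ = Reversal.reverse-run Γ r
  ∣B'∣≡k : ∣ B' ∣ ≡ k
  ∣B'∣≡k = +-cancelʳ-≡ (length L) ∣ B' ∣ k (begin
    ∣ B' ∣ + length L            ≡⟨ cong (∣ B' ∣ +_) (sym (length-reversed L)) ⟩
    ∣ B' ∣ + length (reversed L) ≡⟨ Runs.complete-run-card (transpose Γ) rᵀ ∈∁⊥ ⟩
    n                            ≡⟨ sym (Runs.complete-run-card Γ r (λ v → stage-blue s v (full v))) ⟩
    ∣ B ∣ + length L             ≡⟨ cong (_+ length L) ∣B∣≡k ⟩
    k + length L                 ∎)

-- Least elements

least : (P : ℕ → Set) → (∀ m → Dec (P m)) → ∀ s → P s → Σ ℕ λ m → m ≤ s × IsMin P m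
least P P? = <-rec (λ s → P s → Σ ℕ λ m → m ≤ s × IsMin P m) search
  where
  search : ∀ s → (∀ {r} → r < s → P r → Σ ℕ λ m → m ≤ r × IsMin P m) →
           P s → Σ ℕ λ m → m ≤ s × IsMin P m
  search s below Ps with anyUpTo? P? s
  ... | yes (r , r<s , Pr) = Product.map₂ (Product.map₁ (λ m≤r → ≤-trans m≤r (<⇒≤ r<s))) (below r<s Pr)
  ... | no none = s , ≤-refl , Ps , λ m Pm → ≮⇒≥ (λ m<s → none (m , m<s , Pm))

IsMin-cong : ∀ {P Q : ℕ → Set} {t} → (∀ s → P s → Q s) → (∀ s → Q s → P s) → IsMin P t → IsMin Q t
IsMin-cong P→Q Q→P (Pt , least-t) = P→Q _ Pt , λ m Qm → least-t m (Q→P m Qm)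

∃-list? : ∀ {A : Set} → (∀ {P : A → Set} → (∀ a → Dec (P a)) → Dec (Σ A P)) →
          (P : List A → Set) → (∀ xs → Dec (P xs)) → ∀ m → Dec (Σ (List A) λ xs → length xs ≤ m × P xs)
∃-list? ∃? P P? zero with P? []
... | yes P[] = yes ([] , z≤n , P[])
... | no ¬P[] = no λ { ([] , _ , P[]) → ¬P[] P[] ; (_ ∷ _ , () , _) }
∃-list? ∃? P P? (suc m) with P? [] | ∃? (λ x → ∃-list? ∃? (P ∘ (x ∷_)) (P? ∘ (x ∷_)) m)
... | yes P[] | _ = yes ([] , z≤n , P[])
... | no _ | yes (x , xs , len , Pxs) = yes (x ∷ xs , s≤s len , Pxs)
... | no ¬P[] | no none = no λ { ([] , _ , P[]) → ¬P[] P[] ; (x ∷ xs , s≤s len , Pxs) → none (x , xs , len , Pxs) }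

∃-force? : ∀ {n} {P : Force n → Set} → (∀ f → Dec (P f)) → Dec (Σ (Force n) P)
∃-force? P? = map′ (λ (u , w , p) → (u , w) , p) (λ ((u , w) , p) → u , w , p)
                   (FinP.any? λ u → FinP.any? λ w → P? (u , w))

module Minima {n : ℕ} (Γ : Digraph n) where
  open Decisions Γ using (forces-of?; full?)

  -- Reaching by time s is decidable, since runs have at most n forces.
  reaches? : ∀ B s → Dec (Reaches Γ B s)
  reaches? B s with ∃-list? ∃-force? (λ F → ForcesOf Γ B F × Full Γ B F s)
                                     (λ F → forces-of? B F ×-dec full? B F s) n
  ... | yes (F , _ , reach) = yes (F , reach)
  ... | no none = no λ { (F , (T , r , stalled) , full) →
                         none (F , Runs.run-length≤n Γ r , (T , r , stalled) , full) }

  ptB-least : ∀ {B m} → IsMin (Reaches Γ B) m → PtB Γ B m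
  ptB-least ((F , forces , full) , least-m) =
    (F , forces , full , λ m' full' → least-m m' (F , forces , full')) ,
    λ { s (F' , forces' , full' , _) → least-m s (F' , forces' , full') }

  ptB-reaches : ∀ {B m} → PtB Γ B m → Reaches Γ B m
  ptB-reaches ((F , forces , full , _) , _) = F , forces , full

  ptB-exists : ∀ {B s} → Reaches Γ B s → Σ ℕ λ m → m ≤ s × PtB Γ B m
  ptB-exists {B} {s} reach = Product.map₂ (Product.map₂ ptB-least) (least (Reaches Γ B) (reaches? B) s reach)

  ptk→least : ∀ {k t} → Ptk Γ k t → IsMin (Achieves Γ k) t
  ptk→least ((B , zfs , ∣B∣≡k , ptB) , least-t) =
    (B , zfs , ∣B∣≡k , ptB-reaches ptB) ,
    λ { s (B' , zfs' , ∣B'∣≡k , reach) → let (m , m≤s , ptB') = ptB-exists reach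
                                         in ≤-trans (least-t m (B' , zfs' , ∣B'∣≡k , ptB')) m≤s }

  least→ptk : ∀ {k t} → IsMin (Achieves Γ k) t → Ptk Γ k t
  least→ptk {t = t} ((B , zfs , ∣B∣≡k , reach) , least-t) with ptB-exists reach
  ... | m , m≤t , ptB =
    (B , zfs , ∣B∣≡k , subst (PtB Γ B) m≡t ptB) ,
    λ { s (B' , zfs' , ∣B'∣≡k , ptB') → least-t s (B' , zfs' , ∣B'∣≡k , ptB-reaches ptB') }
    where
    m≡t : m ≡ t
    m≡t = ≤-antisym m≤t (least-t m (B , zfs , ∣B∣≡k , ptB-reaches ptB))

-- Lemma 2.14: pt_k(Γ) = pt_k(Γᵀ).
lemma2p14 : ∀ {n} (Γ : Digraph n) (k z : ℕ) → ZeroForcingNumber Γ z → z ≤ k → k ≤ n →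
    ∀ t → Ptk Γ k t ⇔ Ptk (transpose Γ) k t
lemma2p14 {n} Γ k _ _ _ _ t = mk⇔ (transfer Γ) (transfer (transpose Γ))
  where
  -- (Γᵀ)ᵀ is Γ by definition, so reversal transports achievability both ways.
  transfer : (Δ : Digraph n) → Ptk Δ k t → Ptk (transpose Δ) k t
  transfer Δ = Minima.least→ptk (transpose Δ)
             ∘ IsMin-cong (λ _ → achieves-transpose Δ) (λ _ → achieves-transpose (transpose Δ))
             ∘ Minima.ptk→least Δ
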